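{- Let $G=(A,B,E)$ be a bipartite graph with $m=|E|$ edges and maximum matching $M^*$, whose edges arrive in a uniformly random order $\pi$. Let $0<\alpha\le\frac12<\beta<1$, $M_G=\mathrm{Greedy}(\pi)$, $M_0=\mathrm{Greedy}(\pi[1,\alpha m])$, $F_1$ the set of all pairs between $B(M_0)$ and $A\setminus A(M_0)$, $M_1=\mathrm{Greedy}(F_1\cap\pi(\alpha m,\beta m])$, and $A'=\{a\in A:\exists b\in B(M_1)\text{ with } ab\in M_0\}$. If $\mathbb{E}_\pi|M_G|\le(\frac12+\epsilon)|M^*|$, then $$\mathbb{E}_\pi|\mathrm{opt}(A',B\setminus B(M_0))|\ \ge\ \mathbb{E}_\pi|M_1|-4\epsilon|M^*|.$$
   Context: $\mathrm{Greedy}(\sigma)$: start with $M=\emptyset$, process the edges of $\sigma$ in order, adding $e$ to $M$ whenever $M\cup\{e\}$ is a matching; output $M$. $\pi[1,\alpha m]$ is the first $\lfloor\alpha m\rfloor$ edges of $\pi$, and $\pi(\alpha m,\beta m]$ is $\pi[\lfloor\alpha m\rfloor+1],\dots,\pi[\lfloor\beta m\rfloor]$. $F_1\cap\sigma$ is the subsequence of $\sigma$ of edges in $F_1$. $A(M)$, $B(M)$ are vertices of $A$, resp. $B$, covered by $M$. $\mathrm{opt}(S_A,S_B)$ is a maximum matching of the subgraph of $G$ induced by $S_A\cup S_B$. Expectations are over $\pi$.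
   Formalization: The parameters α, β and ε are taken to be rational numbers. -}

module Defs where

open import Data.Nat using (ℕ; zero; suc; _⊔_)
open import Data.Fin using (Fin) renaming (_≟_ to _≟ᶠ_)
open import Data.Bool using (Bool; true; false; _∧_; _∨_; not; if_then_else_)
open import Data.List using (List; []; _∷_; length; map; filter; take; drop; concatMap; foldr)
open import Data.Bool.ListAction using (any)
open import Data.Nat.ListAction using (sum)
open import Data.Product using (_×_; _,_; proj₁; proj₂)
open import Data.Integer using (+_)
open import Data.Rational using (ℚ; 0ℚ; _/_)
open import Relation.Nullary using (does)

Edge : ℕ → ℕ → Set
Edge p q = Fin p × Fin q

module _ {p q : ℕ} where

  _∈A_ : Fin p → List (Edge p q) → Bool
  a ∈A M = any (λ e → does (proj₁ e ≟ᶠ a)) M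

  _∈B_ : Fin q → List (Edge p q) → Bool
  b ∈B M = any (λ e → does (proj₂ e ≟ᶠ b)) M

  addable : List (Edge p q) → Edge p q → Bool
  addable M (a , b) = not (a ∈A M) ∧ not (b ∈B M)

  greedyFrom : List (Edge p q) → List (Edge p q) → List (Edge p q)
  greedyFrom M [] = M
  greedyFrom M (e ∷ σ) = if addable M e then greedyFrom (e ∷ M) σ else greedyFrom M σ

  Greedy : List (Edge p q) → List (Edge p q)
  Greedy σ = greedyFrom [] σ

  isMatching : List (Edge p q) → Bool
  isMatching [] = true
  isMatching (e ∷ M) = addable M e ∧ isMatching M

  subseqs : {X : Set} → List X → List (List X)
  subseqs [] = [] ∷ []
  subseqs (x ∷ xs) = let r = subseqs xs in map (x ∷_) r Data.List.++ r

  maximumℕ : List ℕ → ℕ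
  maximumℕ = foldr _⊔_ 0

  ν : List (Edge p q) → ℕ
  ν es = maximumℕ (map length (filter (λ M → isMatching M Data.Bool.≟ true) (subseqs es)))

  -- opt(S_A, S_B): max matching of the subgraph induced by S_A ∪ S_B (given as predicates);
  -- since G is bipartite the induced subgraph has the edges ab of G with a ∈ S_A, b ∈ S_B.
  optSize : List (Edge p q) → (Fin p → Bool) → (Fin q → Bool) → ℕ
  optSize es SA SB = ν (filter (λ e → SA (proj₁ e) ∧ SB (proj₂ e) Data.Bool.≟ true) es)

-- all orderings of a list (by repeated insertion); for a list of distinct
-- elements each of its length! orderings occurs exactly once.
insertions : {X : Set} → X → List X → List (List X)
insertions x [] = (x ∷ []) ∷ []
insertions x (y ∷ ys) = (x ∷ y ∷ ys) ∷ map (y ∷_) (insertions x ys)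

orderings : {X : Set} → List X → List (List X)
orderings [] = [] ∷ []
orderings (x ∷ xs) = concatMap (insertions x) (orderings xs)

expect : {X : Set} → List X → (X → ℕ) → ℚ
expect [] f = 0ℚ
expect (x ∷ xs) f = (+ sum (map f (x ∷ xs))) / suc (length xs)

floorMul : ℚ → ℕ → ℕ
floorMul α m = Data.Integer.∣ Data.Rational.floor (α Data.Rational.* ((+ m) / 1)) ∣

prefix : {X : Set} → ℚ → List X → List X
prefix α π = take (floorMul α (length π)) π

window : {X : Set} → ℚ → ℚ → List X → List X
window α β π = drop (floorMul α (length π)) (take (floorMul β (length π)) π)

module _ {p q : ℕ} (π : List (Edge p q)) (α β : ℚ) where
  M₀ : List (Edge p q)
  M₀ = Greedy (prefix α π)

  inF₁ : Edge p q → Bool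
  inF₁ (a , b) = (b ∈B M₀) ∧ not (a ∈A M₀)

  M₁ : List (Edge p q)
  M₁ = Greedy (filter (λ e → inF₁ e Data.Bool.≟ true) (window α β π))

  A' : Fin p → Bool
  A' a = any (λ e → does (proj₁ e ≟ᶠ a) ∧ (proj₂ e ∈B M₁)) M₀

  BnotM₀ : Fin q → Bool
  BnotM₀ b = not (b ∈B M₀)

-- Fix an ordering π that contains every edge, let G = Greedy π and let M* be a maximum
-- matching; we show |M₁| + 2|M*| ≤ opt(A′, B ∖ B(M₀)) + 4|G| for every such π, and the
-- theorem follows by averaging over π and using E|G| ≤ (½ + ε)|M*|.
-- Since M₀ ⊆ G and the B-endpoints of M₁ are distinct vertices of B(M₀), whose M₀-partners
-- lie in A′, |M₁| is at most the number of edges of G with A-endpoint in A′.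
-- The edges of M* inside A′ × (B ∖ B(M₀)) number at most opt. Charge every other edge of
-- M* to its A-endpoint if that is matched by G and lies outside A′, and to its B-endpoint
-- otherwise; that B-endpoint is matched by G, by maximality of G or because B(M₀) ⊆ B(G).
-- Disjoint edges get distinct charges, so these edges number at most
-- |{g ∈ G : a_g ∉ A′}| + |G|; the same charging gives |M*| ≤ 2|G|.

module Submission where

open import Defs
open import Data.Bool using (true)
import Data.Bool as Bool
open import Data.List using (List; length; filter)
open import Data.List.Membership.Propositional using (_∈_)
open import Data.List.Membership.Propositional.Properties using (∈-filter⁻)
open import Data.List.Relation.Binary.Subset.Propositional using (_⊆_)
open import Data.Nat using (ℕ)
import Data.Nat as ℕ
open import Data.Product using (_,_; proj₁; proj₂)
open import Data.Rational using (ℚ)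
open import Function using (_∘_)
open import Relation.Binary.PropositionalEquality using (_≡_)

module Lists where
  open import Data.Nat.Properties
  open import Algebra.Properties.CommutativeSemigroup +-commutativeSemigroup using (interchange)
  open import Data.Bool using (Bool; true; false; _∧_; not)
  import Data.Bool as Bool
  open import Data.Bool.ListAction using (any)
  open import Data.Bool.Properties using (T-≡)
  open import Data.Empty using (⊥-elim)
  open import Data.List using (List; []; _∷_; length; map; filter; foldr; _++_)
  open import Data.List.Properties using (length-++; length-map)
  open import Data.List.Membership.Propositional using (_∈_; lose)
  open import Data.List.Membership.Propositional.Properties
    using (∈-∃++; ∈-++⁻; ∈-++⁺ˡ; ∈-++⁺ʳ; ∈-map⁻)
  open import Data.List.Relation.Binary.Subset.Propositional using (_⊆_)
  open import Data.List.Relation.Unary.Any using (here; there)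
  open import Data.List.Relation.Unary.Any.Properties using (any⁺)
  import Data.List.Relation.Unary.All as All
  open import Data.List.Relation.Unary.AllPairs using (AllPairs; _∷_)
  import Data.List.Relation.Unary.AllPairs.Properties as AllPairs
  open import Data.List.Relation.Unary.Unique.Propositional using (Unique)
  open import Data.Nat using (ℕ; suc; _+_; _*_; _≤_; _⊔_; z≤n; s≤s)
  open import Data.Nat.ListAction using (sum)
  open import Data.Product using (_×_; _,_)
  open import Data.Sum using (_⊎_; inj₁; inj₂)
  open import Function using (Equivalence; _∘_)
  open import Relation.Binary.Definitions using (DecidableEquality)
  open import Relation.Binary.PropositionalEquality
  open import Relation.Nullary using (does; yes; no; contradiction)

  private variable
    X Y : Set
    x : X
    xs : List X
    ys : List Y

  ∧-true⁻ : ∀ b {c} → b ∧ c ≡ true → b ≡ true × c ≡ true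
  ∧-true⁻ true {true} _ = refl , refl

  any-true⁺ : (f : X → Bool) → x ∈ xs → f x ≡ true → any f xs ≡ true
  any-true⁺ f x∈xs fx = Equivalence.to T-≡ (any⁺ f (lose x∈xs (Equivalence.from T-≡ fx)))

  module _ (_≟_ : DecidableEquality Y) (f : X → Y) {y : Y} where

    any-≟⇒∈-map : ∀ {xs} → any (λ x → does (f x ≟ y)) xs ≡ true → y ∈ map f xs
    any-≟⇒∈-map {x ∷ xs} h with f x ≟ y
    ... | yes fx≡y = here (sym fx≡y)
    ... | no _ = there (any-≟⇒∈-map h)

    ∈-map⇒any-≟ : ∀ {xs} → y ∈ map f xs → any (λ x → does (f x ≟ y)) xs ≡ true
    ∈-map⇒any-≟ {x ∷ xs} y∈ with f x ≟ y | y∈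
    ... | yes _ | _ = refl
    ... | no fx≢y | here y≡fx = contradiction (sym y≡fx) fx≢y
    ... | no _ | there y∈′ = ∈-map⇒any-≟ y∈′

  Unique-⊆⇒length-≤ : {xs ys : List X} → Unique xs → xs ⊆ ys → length xs ≤ length ys
  Unique-⊆⇒length-≤ {xs = []} _ _ = z≤n
  Unique-⊆⇒length-≤ {xs = x ∷ xs} (x∉xs ∷ xs!) xs⊆ys
    with us , vs , refl ← ∈-∃++ (xs⊆ys (here refl)) = begin
      suc (length xs)              ≤⟨ s≤s (Unique-⊆⇒length-≤ xs! xs⊆us++vs) ⟩
      suc (length (us ++ vs))      ≡⟨ cong suc (length-++ us) ⟩
      suc (length us + length vs)  ≡⟨ +-suc (length us) (length vs) ⟨
      length us + length (x ∷ vs)  ≡⟨ length-++ us ⟨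
      length (us ++ x ∷ vs)        ∎
    where
    open ≤-Reasoning
    xs⊆us++vs : xs ⊆ us ++ vs
    xs⊆us++vs y∈xs with ∈-++⁻ us (xs⊆ys (there y∈xs))
    ... | inj₁ y∈us = ∈-++⁺ˡ y∈us
    ... | inj₂ (here refl) = ⊥-elim (All.lookup x∉xs y∈xs refl)
    ... | inj₂ (there y∈vs) = ∈-++⁺ʳ us y∈vs

  length-≤-by-injection : (f : X → Y) → AllPairs (λ x x′ → f x ≢ f x′) xs →
    (∀ {x} → x ∈ xs → f x ∈ ys) → length xs ≤ length ys
  length-≤-by-injection {xs = xs} {ys = ys} f f-injective f-into =
    subst (_≤ length ys) (length-map f xs) (Unique-⊆⇒length-≤ (AllPairs.map⁺ f-injective) f[xs]⊆ys)
    where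
    f[xs]⊆ys : map f xs ⊆ ys
    f[xs]⊆ys y∈ with _ , x∈xs , refl ← ∈-map⁻ f y∈ = f-into x∈xs

  length-filter-true+false : (f : X → Bool) (xs : List X) →
    length (filter (λ x → f x Bool.≟ true) xs) + length (filter (λ x → not (f x) Bool.≟ true) xs)
      ≡ length xs
  length-filter-true+false f [] = refl
  length-filter-true+false f (x ∷ xs) with f x
  ... | true = cong suc (length-filter-true+false f xs)
  ... | false = trans (+-suc _ _) (cong suc (length-filter-true+false f xs))

  ≤-foldr-⊔ : ∀ {n ns} → n ∈ ns → n ≤ foldr _⊔_ 0 ns
  ≤-foldr-⊔ {ns = m ∷ ns} (here refl) = m≤m⊔n m _
  ≤-foldr-⊔ {ns = m ∷ ns} (there n∈ns) = ≤-trans (≤-foldr-⊔ n∈ns) (m≤n⊔m m _)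

  foldr-⊔-sel : ∀ ns → foldr _⊔_ 0 ns ≡ 0 ⊎ foldr _⊔_ 0 ns ∈ ns
  foldr-⊔-sel [] = inj₁ refl
  foldr-⊔-sel (m ∷ ns) with ⊔-sel m (foldr _⊔_ 0 ns) | foldr-⊔-sel ns
  ... | inj₁ ≡m | _ = inj₂ (here ≡m)
  ... | inj₂ ≡max | inj₁ max≡0 = inj₁ (trans ≡max max≡0)
  ... | inj₂ ≡max | inj₂ max∈ns = inj₂ (there (subst (_∈ ns) (sym ≡max) max∈ns))

  sum-map-+ : (f g : X → ℕ) (xs : List X) →
    sum (map (λ x → f x + g x) xs) ≡ sum (map f xs) + sum (map g xs)
  sum-map-+ f g [] = refl
  sum-map-+ f g (x ∷ xs) = trans (cong (f x + g x +_) (sum-map-+ f g xs))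
    (interchange (f x) (g x) (sum (map f xs)) (sum (map g xs)))

  sum-map-*ˡ : (c : ℕ) (f : X → ℕ) (xs : List X) → sum (map (λ x → c * f x) xs) ≡ c * sum (map f xs)
  sum-map-*ˡ c f [] = sym (*-zeroʳ c)
  sum-map-*ˡ c f (x ∷ xs) = trans (cong (c * f x +_) (sum-map-*ˡ c f xs)) (sym (*-distribˡ-+ c (f x) _))

  sum-map-const : (c : ℕ) (xs : List X) → sum (map (λ _ → c) xs) ≡ c * length xs
  sum-map-const c [] = sym (*-zeroʳ c)
  sum-map-const c (x ∷ xs) = trans (cong (c +_) (sum-map-const c xs)) (sym (*-suc c (length xs)))

  sum-mono-≤ : {f g : X → ℕ} → (∀ {x} → x ∈ xs → f x ≤ g x) → sum (map f xs) ≤ sum (map g xs)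
  sum-mono-≤ {xs = []} f≤g = z≤n
  sum-mono-≤ {xs = x ∷ xs} f≤g = +-mono-≤ (f≤g (here refl)) (sum-mono-≤ (f≤g ∘ there))

module Orderings where
  open import Data.List using (List; []; _∷_)
  open import Data.List.Membership.Propositional using (_∈_; find)
  open import Data.List.Membership.Propositional.Properties using (∈-map⁻; ∈-concatMap⁺; ∈-concatMap⁻)
  open import Data.List.Relation.Binary.Subset.Propositional using (_⊆_)
  open import Data.List.Relation.Unary.Any using (here; there)
  import Data.List.Relation.Unary.Any as Any
  open import Data.Product using (_,_)
  open import Relation.Binary.PropositionalEquality using (refl)

  private variable
    X : Set
    x : X
    xs π : List X

  ∷-∈-insertions : ∀ (x : X) xs → x ∷ xs ∈ insertions x xs
  ∷-∈-insertions x [] = here refl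
  ∷-∈-insertions x (_ ∷ _) = here refl

  insertions-⊇ : π ∈ insertions x xs → x ∷ xs ⊆ π
  insertions-⊇ {xs = []} (here refl) z∈ = z∈
  insertions-⊇ {xs = y ∷ ys} (here refl) z∈ = z∈
  insertions-⊇ {xs = y ∷ ys} (there π∈) z∈ with ρ , ρ∈ , refl ← ∈-map⁻ (y ∷_) π∈ with z∈
  ... | here refl = there (insertions-⊇ ρ∈ (here refl))
  ... | there (here refl) = here refl
  ... | there (there z∈ys) = there (insertions-⊇ ρ∈ (there z∈ys))

  ∈-orderings : ∀ (xs : List X) → xs ∈ orderings xs
  ∈-orderings [] = here refl
  ∈-orderings (x ∷ xs) =
    ∈-concatMap⁺ (insertions x) (Any.map (λ { refl → ∷-∈-insertions x xs }) (∈-orderings xs))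

  orderings-⊇ : π ∈ orderings xs → xs ⊆ π
  orderings-⊇ {xs = x ∷ xs} π∈ z∈
    with ρ , ρ∈ , π∈insertions ← find (∈-concatMap⁻ (insertions x) {xs = orderings xs} π∈) with z∈
  ... | here refl = insertions-⊇ π∈insertions (here refl)
  ... | there z∈xs = insertions-⊇ π∈insertions (there (orderings-⊇ ρ∈ z∈xs))

module Matchings {p q : ℕ} where
  open Lists
  open import Data.Bool using (true; false; _∧_)
  import Data.Bool as Bool
  open import Data.Empty using (⊥-elim)
  open import Data.Fin using (Fin; _≟_)
  open import Data.List using (List; []; _∷_; length; map; filter; take; drop; _++_)
  open import Data.List.Properties using (take++drop≡id)
  open import Data.List.Membership.Propositional using (_∈_)
  open import Data.List.Membership.Propositional.Properties
    using (∈-++⁺ˡ; ∈-++⁺ʳ; ∈-++⁻; ∈-map⁺; ∈-map⁻; ∈-filter⁺; ∈-filter⁻)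
  open import Data.List.Relation.Binary.Sublist.Propositional
    using ([]; _∷_; _∷ʳ_; minimum) renaming (_⊆_ to _⊑_)
  open import Data.List.Relation.Binary.Subset.Propositional using (_⊆_)
  import Data.List.Relation.Binary.Subset.Propositional.Properties as Subset
  open import Data.List.Relation.Unary.All using (All)
  import Data.List.Relation.Unary.All as All
  open import Data.List.Relation.Unary.AllPairs using (AllPairs; []; _∷_)
  open import Data.List.Relation.Unary.Any using (here; there)
  open import Data.Nat using (ℕ; _≤_)
  open import Data.Product using (_×_; _,_; proj₁; proj₂; ∃-syntax)
  open import Data.Sum using (_⊎_; inj₁; inj₂)
  import Data.Sum as Sum
  open import Function using (_∘_)
  open import Relation.Binary.PropositionalEquality
  open import Relation.Nullary using (Dec; contradiction)

  private variable
    a : Fin p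
    b : Fin q
    e : Edge p q
    M M′ σ : List (Edge p q)

  Disjoint : Edge p q → Edge p q → Set
  Disjoint e e′ = proj₁ e ≢ proj₁ e′ × proj₂ e ≢ proj₂ e′

  Matching : List (Edge p q) → Set
  Matching = AllPairs Disjoint

  data Covered (M : List (Edge p q)) (e : Edge p q) : Set where
    A-covered : proj₁ e ∈A M ≡ true → Covered M e
    B-covered : proj₂ e ∈B M ≡ true → Covered M e

  ∈A⇒∈-map : a ∈A M ≡ true → a ∈ map proj₁ M
  ∈A⇒∈-map = any-≟⇒∈-map _≟_ proj₁

  ∈-map⇒∈A : a ∈ map proj₁ M → a ∈A M ≡ true
  ∈-map⇒∈A = ∈-map⇒any-≟ _≟_ proj₁

  ∈B⇒∈-map : b ∈B M ≡ true → b ∈ map proj₂ M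
  ∈B⇒∈-map = any-≟⇒∈-map _≟_ proj₂

  ∈-map⇒∈B : b ∈ map proj₂ M → b ∈B M ≡ true
  ∈-map⇒∈B = ∈-map⇒any-≟ _≟_ proj₂

  ∈⇒∈A : e ∈ M → proj₁ e ∈A M ≡ true
  ∈⇒∈A e∈M = ∈-map⇒∈A (∈-map⁺ proj₁ e∈M)

  ∈⇒∈B : e ∈ M → proj₂ e ∈B M ≡ true
  ∈⇒∈B e∈M = ∈-map⇒∈B (∈-map⁺ proj₂ e∈M)

  ∈A-mono : M ⊆ M′ → a ∈A M ≡ true → a ∈A M′ ≡ true
  ∈A-mono M⊆M′ = ∈-map⇒∈A ∘ Subset.map⁺ proj₁ M⊆M′ ∘ ∈A⇒∈-map

  ∈B-mono : M ⊆ M′ → b ∈B M ≡ true → b ∈B M′ ≡ true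
  ∈B-mono M⊆M′ = ∈-map⇒∈B ∘ Subset.map⁺ proj₂ M⊆M′ ∘ ∈B⇒∈-map

  Covered-mono : M ⊆ M′ → Covered M e → Covered M′ e
  Covered-mono M⊆M′ (A-covered a∈M) = A-covered (∈A-mono M⊆M′ a∈M)
  Covered-mono M⊆M′ (B-covered b∈M) = B-covered (∈B-mono M⊆M′ b∈M)

  ∈A-false⇒≢ : a ∈A M ≡ false → e ∈ M → a ≢ proj₁ e
  ∈A-false⇒≢ a∉M e∈M refl = contradiction (trans (sym (∈⇒∈A e∈M)) a∉M) λ ()

  ∈B-false⇒≢ : b ∈B M ≡ false → e ∈ M → b ≢ proj₂ e
  ∈B-false⇒≢ b∉M e∈M refl = contradiction (trans (sym (∈⇒∈B e∈M)) b∉M) λ ()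

  addable⇒All-Disjoint : ∀ (M : List (Edge p q)) e → addable M e ≡ true → All (Disjoint e) M
  addable⇒All-Disjoint M (a , b) h with a ∈A M in a∉M | b ∈B M in b∉M
  ... | false | false = All.tabulate λ e′∈M → ∈A-false⇒≢ a∉M e′∈M , ∈B-false⇒≢ b∉M e′∈M

  All-Disjoint⇒addable : ∀ (M : List (Edge p q)) e → All (Disjoint e) M → addable M e ≡ true
  All-Disjoint⇒addable M (a , b) e-disjoint with a ∈A M in a∈M | b ∈B M in b∈M
  ... | false | false = refl
  ... | true | _ = let e′ , e′∈M , a≡ = ∈-map⁻ proj₁ (∈A⇒∈-map a∈M)
                   in ⊥-elim (proj₁ (All.lookup e-disjoint e′∈M) a≡)
  ... | false | true = let e′ , e′∈M , b≡ = ∈-map⁻ proj₂ (∈B⇒∈-map b∈M)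
                       in ⊥-elim (proj₂ (All.lookup e-disjoint e′∈M) b≡)

  ¬addable⇒Covered : ∀ (M : List (Edge p q)) e → addable M e ≡ false → Covered M e
  ¬addable⇒Covered M (a , b) _ with a ∈A M in a∈M | b ∈B M in b∈M
  ... | true | _ = A-covered a∈M
  ... | false | true = B-covered b∈M

  isMatching⇒Matching : ∀ (M : List (Edge p q)) → isMatching M ≡ true → Matching M
  isMatching⇒Matching [] _ = []
  isMatching⇒Matching (e ∷ M) h with e-addable , M-matching ← ∧-true⁻ (addable M e) h =
    addable⇒All-Disjoint M e e-addable ∷ isMatching⇒Matching M M-matching

  Matching⇒isMatching : ∀ (M : List (Edge p q)) → Matching M → isMatching M ≡ true
  Matching⇒isMatching [] [] = refl
  Matching⇒isMatching (e ∷ M) (e-disjoint ∷ M-matching)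
    rewrite All-Disjoint⇒addable M e e-disjoint = Matching⇒isMatching M M-matching

  ⊑⇒∈-subseqs : ∀ {M es : List (Edge p q)} → M ⊑ es → M ∈ subseqs {p} {q} es
  ⊑⇒∈-subseqs [] = here refl
  ⊑⇒∈-subseqs (e ∷ʳ τ) = ∈-++⁺ʳ _ (⊑⇒∈-subseqs τ)
  ⊑⇒∈-subseqs (refl ∷ τ) = ∈-++⁺ˡ (∈-map⁺ _ (⊑⇒∈-subseqs τ))

  ∈-subseqs⇒⊑ : ∀ {M : List (Edge p q)} (es : List (Edge p q)) → M ∈ subseqs {p} {q} es → M ⊑ es
  ∈-subseqs⇒⊑ [] (here refl) = []
  ∈-subseqs⇒⊑ (e ∷ es) M∈ with ∈-++⁻ (map (e ∷_) (subseqs {p} {q} es)) M∈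
  ... | inj₁ M∈e∷ with M′ , M′∈ , refl ← ∈-map⁻ (e ∷_) M∈e∷ = refl ∷ ∈-subseqs⇒⊑ es M′∈
  ... | inj₂ M∈′ = e ∷ʳ ∈-subseqs⇒⊑ es M∈′

  private
    matching? : (M : List (Edge p q)) → Dec (isMatching M ≡ true)
    matching? M = isMatching M Bool.≟ true

  Matching⇒length-≤-ν : ∀ {M es : List (Edge p q)} → M ⊑ es → Matching M → length M ≤ ν es
  Matching⇒length-≤-ν {M} τ M-matching = ≤-foldr-⊔ (∈-map⁺ length
    (∈-filter⁺ matching? (⊑⇒∈-subseqs τ) (Matching⇒isMatching M M-matching)))

  ν-attained : ∀ (es : List (Edge p q)) → ∃[ M ] M ⊑ es × Matching M × length M ≡ ν es
  ν-attained es with foldr-⊔-sel (map length (filter matching? (subseqs {p} {q} es)))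
  ... | inj₁ ν≡0 = [] , minimum es , [] , sym ν≡0
  ... | inj₂ ν∈ with M , M∈ , ν≡ ← ∈-map⁻ length ν∈
                with M∈subseqs , M-matching ← ∈-filter⁻ matching? {xs = subseqs {p} {q} es} M∈ =
    M , ∈-subseqs⇒⊑ es M∈subseqs , isMatching⇒Matching M M-matching , sym ν≡

  greedyFrom-++ : ∀ (M σ τ : List (Edge p q)) → greedyFrom M (σ ++ τ) ≡ greedyFrom (greedyFrom M σ) τ
  greedyFrom-++ M [] τ = refl
  greedyFrom-++ M (e ∷ σ) τ with addable M e
  ... | true = greedyFrom-++ (e ∷ M) σ τ
  ... | false = greedyFrom-++ M σ τ

  greedyFrom-⊇ : ∀ (M σ : List (Edge p q)) → M ⊆ greedyFrom M σ
  greedyFrom-⊇ M [] = λ e∈M → e∈M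
  greedyFrom-⊇ M (e ∷ σ) with addable M e
  ... | true = greedyFrom-⊇ (e ∷ M) σ ∘ there
  ... | false = greedyFrom-⊇ M σ

  greedyFrom-⊆ : ∀ (M σ : List (Edge p q)) → e ∈ greedyFrom M σ → e ∈ M ⊎ e ∈ σ
  greedyFrom-⊆ M [] = inj₁
  greedyFrom-⊆ M (e ∷ σ) e′∈ with addable M e
  ... | false = Sum.map₂ there (greedyFrom-⊆ M σ e′∈)
  ... | true with greedyFrom-⊆ (e ∷ M) σ e′∈
  ...   | inj₁ (here e′≡e) = inj₂ (here e′≡e)
  ...   | inj₁ (there e′∈M) = inj₁ e′∈M
  ...   | inj₂ e′∈σ = inj₂ (there e′∈σ)

  greedyFrom-isMatching : ∀ (M σ : List (Edge p q)) →
    isMatching M ≡ true → isMatching (greedyFrom M σ) ≡ true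
  greedyFrom-isMatching M [] M-matching = M-matching
  greedyFrom-isMatching M (e ∷ σ) M-matching with addable M e in e-addable
  ... | true = greedyFrom-isMatching (e ∷ M) σ (trans (cong (_∧ isMatching M) e-addable) M-matching)
  ... | false = greedyFrom-isMatching M σ M-matching

  greedyFrom-maximal : ∀ (M σ : List (Edge p q)) → e ∈ σ → Covered (greedyFrom M σ) e
  greedyFrom-maximal M (e ∷ σ) (here refl) with addable M e in e-addable
  ... | true = Covered-mono (greedyFrom-⊇ (e ∷ M) σ) (A-covered (∈⇒∈A {M = e ∷ M} (here refl)))
  ... | false = Covered-mono (greedyFrom-⊇ M σ) (¬addable⇒Covered M e e-addable)
  greedyFrom-maximal M (e′ ∷ σ) (there e∈σ) with addable M e′
  ... | true = greedyFrom-maximal (e′ ∷ M) σ e∈σ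
  ... | false = greedyFrom-maximal M σ e∈σ

  Greedy-matching : ∀ (σ : List (Edge p q)) → Matching (Greedy σ)
  Greedy-matching σ = isMatching⇒Matching (Greedy σ) (greedyFrom-isMatching [] σ refl)

  Greedy-maximal : ∀ (σ : List (Edge p q)) → e ∈ σ → Covered (Greedy σ) e
  Greedy-maximal = greedyFrom-maximal []

  Greedy-⊆ : ∀ (σ : List (Edge p q)) → Greedy σ ⊆ σ
  Greedy-⊆ σ e∈ with greedyFrom-⊆ [] σ e∈
  ... | inj₁ ()
  ... | inj₂ e∈σ = e∈σ

  Greedy-take-⊆ : ∀ k (σ : List (Edge p q)) → Greedy (take k σ) ⊆ Greedy σ
  Greedy-take-⊆ k σ =
    subst (Greedy (take k σ) ⊆_) Greedy[σ]≡ (greedyFrom-⊇ (Greedy (take k σ)) (drop k σ))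
    where
    Greedy[σ]≡ : greedyFrom (Greedy (take k σ)) (drop k σ) ≡ Greedy σ
    Greedy[σ]≡ = trans (sym (greedyFrom-++ [] (take k σ) (drop k σ))) (cong Greedy (take++drop≡id k σ))

module Charging {p q : ℕ} where
  open Lists
  open Matchings {p} {q}
  open import Data.Bool using (Bool; true; false; _∧_; not)
  import Data.Bool as Bool
  open import Data.Fin using (Fin)
  open import Data.List using (List; length; map; filter; _++_)
  open import Data.List.Properties using (length-++; length-map; length-filter)
  open import Data.List.Membership.Propositional using (_∈_)
  open import Data.List.Membership.Propositional.Properties using (∈-++⁺ˡ; ∈-++⁺ʳ; ∈-map⁺; ∈-map⁻; ∈-filter⁺)
  import Data.List.Relation.Unary.AllPairs as AllPairs
  open import Data.Nat using (_+_; _*_; _≤_)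
  open import Data.Nat.Properties using (+-monoˡ-≤; +-identityʳ; module ≤-Reasoning)
  open import Data.Product using (_,_; proj₁; proj₂)
  open import Data.Sum using (_⊎_; inj₁; inj₂)
  open import Relation.Binary.PropositionalEquality
  open import Relation.Nullary using (contradiction)

  endpoint : Bool → Edge p q → Fin p ⊎ Fin q
  endpoint true e = inj₁ (proj₁ e)
  endpoint false e = inj₂ (proj₂ e)

  Disjoint⇒endpoint-≢ : ∀ c c′ {e e′} → Disjoint e e′ → endpoint c e ≢ endpoint c′ e′
  Disjoint⇒endpoint-≢ true true (a≢a′ , _) refl = a≢a′ refl
  Disjoint⇒endpoint-≢ false false (_ , b≢b′) refl = b≢b′ refl
  Disjoint⇒endpoint-≢ true false _ ()
  Disjoint⇒endpoint-≢ false true _ ()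

  length-≤-charging : (G : List (Edge p q)) (X : Fin p → Bool) (T : List (Edge p q)) → Matching T →
    (∀ {e} → e ∈ T → Covered G e) →
    (∀ {e} → e ∈ T → X (proj₁ e) ≡ true → proj₂ e ∈B G ≡ true) →
    length T ≤ length (filter (λ g → not (X (proj₁ g)) Bool.≟ true) G) + length G
  length-≤-charging G X T T-matching T-covered X⇒∈B =
    subst (length T ≤_) length-targets
      (length-≤-by-injection charge (AllPairs.map (Disjoint⇒endpoint-≢ _ _) T-matching) charge∈targets)
    where
    G∖X : List (Edge p q)
    G∖X = filter (λ g → not (X (proj₁ g)) Bool.≟ true) G

    targets : List (Fin p ⊎ Fin q)
    targets = map inj₁ (map proj₁ G∖X) ++ map inj₂ (map proj₂ G)

    length-targets : length targets ≡ length G∖X + length G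
    length-targets = begin
      length targets                                                ≡⟨ length-++ (map inj₁ (map proj₁ G∖X)) ⟩
      length (map inj₁ (map proj₁ G∖X)) + length (map inj₂ (map proj₂ G))
        ≡⟨ cong₂ _+_ (trans (length-map inj₁ (map proj₁ G∖X)) (length-map proj₁ G∖X))
                     (trans (length-map inj₂ (map proj₂ G)) (length-map proj₂ G)) ⟩
      length G∖X + length G                                         ∎
      where open ≡-Reasoning

    charged : Edge p q → Bool
    charged e = proj₁ e ∈A G ∧ not (X (proj₁ e))

    charge : Edge p q → Fin p ⊎ Fin q
    charge e = endpoint (charged e) e

    uncharged⇒∈B : ∀ {e} → e ∈ T → charged e ≡ false → proj₂ e ∈B G ≡ true
    uncharged⇒∈B {e} e∈T uncharged with T-covered e∈T | X (proj₁ e) in Xa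
    ... | B-covered b∈G | _ = b∈G
    ... | A-covered a∈G | true = X⇒∈B e∈T Xa
    ... | A-covered a∈G | false = contradiction (trans (sym (cong (_∧ true) a∈G)) uncharged) λ ()

    charge∈targets : ∀ {e} → e ∈ T → charge e ∈ targets
    charge∈targets {e} e∈T with charged e in e-charged
    ... | false = ∈-++⁺ʳ (map inj₁ (map proj₁ G∖X))
                    (∈-map⁺ inj₂ (∈B⇒∈-map {M = G} (uncharged⇒∈B e∈T e-charged)))
    ... | true with a∈G , a∉X ← ∧-true⁻ (proj₁ e ∈A G) e-charged
               with g , g∈G , a≡ ← ∈-map⁻ proj₁ (∈A⇒∈-map {M = G} a∈G) =
      ∈-++⁺ˡ (∈-map⁺ inj₁ (subst (_∈ map proj₁ G∖X) (sym a≡) (∈-map⁺ proj₁ g∈G∖X)))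
      where
      g∈G∖X : g ∈ G∖X
      g∈G∖X = ∈-filter⁺ (λ g → not (X (proj₁ g)) Bool.≟ true) g∈G (subst (λ a → not (X a) ≡ true) a≡ a∉X)

  length-≤-2*cover : (G T : List (Edge p q)) → Matching T → (∀ {e} → e ∈ T → Covered G e) →
    length T ≤ 2 * length G
  length-≤-2*cover G T T-matching T-covered = begin
    length T                           ≤⟨ length-≤-charging G (λ _ → false) T T-matching T-covered (λ _ ()) ⟩
    length (filter all? G) + length G  ≤⟨ +-monoˡ-≤ (length G) (length-filter all? G) ⟩
    length G + length G                ≡⟨ cong (length G +_) (+-identityʳ (length G)) ⟨
    2 * length G                       ∎
    where
    open ≤-Reasoning
    all? = λ (g : Edge p q) → not false Bool.≟ true

module GreedyPhases {p q : ℕ} (G M₀ M₁ : List (Edge p q))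
    (M₀⊆G : M₀ ⊆ G) (M₁-matching : Matchings.Matching M₁)
    (B[M₁]⊆B[M₀] : ∀ {e} → e ∈ M₁ → proj₂ e ∈B M₀ ≡ true) where
  open Lists
  open Matchings {p} {q}
  open Charging {p} {q}
  open import Data.Bool using (Bool; false; _∧_; not)
  import Data.Bool as Bool
  open import Data.Bool.ListAction using (any)
  open import Data.Fin using (Fin; _≟_)
  open import Data.List using ([]; _∷_; length; map; filter)
  open import Data.List.Properties using (length-map)
  open import Data.List.Membership.Propositional.Properties using (∈-map⁺; ∈-map⁻; ∈-filter⁺; ∈-filter⁻)
  open import Data.List.Relation.Binary.Sublist.Propositional using () renaming (lookup to ⊑-lookup)
  import Data.List.Relation.Binary.Sublist.Propositional.Properties as Sublist
  import Data.List.Relation.Binary.Subset.Propositional.Properties as Subset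
  import Data.List.Relation.Unary.AllPairs as AllPairs
  import Data.List.Relation.Unary.AllPairs.Properties as AllPairsₚ
  open import Data.Nat using (_+_; _*_; _≤_)
  open import Data.Nat.Properties using (+-mono-≤; module ≤-Reasoning)
  open import Data.Nat.Tactic.RingSolver using (solve)
  open import Data.Product using (_,_; proj₁)
  open import Function using (_∘_)
  open import Relation.Binary.PropositionalEquality
  open import Relation.Nullary using (does)
  open import Relation.Nullary.Decidable using (dec-true)

  -- A′ and B∖B[M₀] unfold to Defs.A' π α β and Defs.BnotM₀ π α β for M₀ = M₀ π α β, M₁ = M₁ π α β.
  A′ : Fin p → Bool
  A′ a = any (λ e → does (proj₁ e ≟ a) ∧ (proj₂ e ∈B M₁)) M₀

  B∖B[M₀] : Fin q → Bool
  B∖B[M₀] b = not (b ∈B M₀)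

  length-M₁-≤ : length M₁ ≤ length (filter (λ g → A′ (proj₁ g) Bool.≟ true) G)
  length-M₁-≤ = subst (length M₁ ≤_) (length-map proj₂ G[A′])
    (length-≤-by-injection proj₂ (AllPairs.map proj₂ M₁-matching) partner)
    where
    G[A′] : List (Edge p q)
    G[A′] = filter (λ g → A′ (proj₁ g) Bool.≟ true) G

    partner : ∀ {e} → e ∈ M₁ → proj₂ e ∈ map proj₂ G[A′]
    partner {e} e∈M₁ with g , g∈M₀ , b≡ ← ∈-map⁻ proj₂ (∈B⇒∈-map {M = M₀} (B[M₁]⊆B[M₀] e∈M₁)) =
      subst (_∈ map proj₂ G[A′]) (sym b≡)
        (∈-map⁺ proj₂ (∈-filter⁺ (λ g → A′ (proj₁ g) Bool.≟ true) (M₀⊆G g∈M₀) g∈A′))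
      where
      g∈A′ : A′ (proj₁ g) ≡ true
      g∈A′ = any-true⁺ _ g∈M₀ (cong₂ _∧_ (dec-true (proj₁ g ≟ proj₁ g) refl)
                                          (subst (λ b → b ∈B M₁ ≡ true) b≡ (∈⇒∈B e∈M₁)))

  private
    combine : ∀ {m₁ a ā g s t o v} → m₁ ≤ a → a + ā ≡ g → s ≤ o → t ≤ ā + g → s + t ≡ v → v ≤ 2 * g →
              m₁ + 2 * v ≤ o + 4 * g
    combine {m₁} {a} {ā} {g} {s} {t} {o} {v} m₁≤a a+ā≡g s≤o t≤ā+g s+t≡v v≤2g = begin
      m₁ + 2 * v                  ≡⟨ solve (m₁ ∷ v ∷ []) ⟩
      m₁ + v + v                  ≡⟨ cong (λ w → m₁ + w + v) s+t≡v ⟨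
      m₁ + (s + t) + v            ≤⟨ +-mono-≤ (+-mono-≤ m₁≤a (+-mono-≤ s≤o t≤ā+g)) v≤2g ⟩
      a + (o + (ā + g)) + 2 * g   ≡⟨ solve (a ∷ ā ∷ o ∷ g ∷ []) ⟩
      o + (a + ā) + 3 * g         ≡⟨ cong (λ w → o + w + 3 * g) a+ā≡g ⟩
      o + g + 3 * g               ≡⟨ solve (o ∷ g ∷ []) ⟩
      o + 4 * g                   ∎
      where open ≤-Reasoning

  bound : (E : List (Edge p q)) → (∀ {e} → e ∈ E → Covered G e) →
    length M₁ + 2 * ν E ≤ optSize E A′ B∖B[M₀] + 4 * length G
  bound E E-covered with M* , M*⊑E , M*-matching , |M*|≡ν ← ν-attained E =
    combine length-M₁-≤ (length-filter-true+false (A′ ∘ proj₁) G) |S|≤opt |T|≤ |S|+|T|≡ν ν≤2|G|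
    where
    inS : Edge p q → Bool
    inS e = A′ (proj₁ e) ∧ B∖B[M₀] (proj₂ e)

    S T : List (Edge p q)
    S = filter (λ e → inS e Bool.≟ true) M*
    T = filter (λ e → not (inS e) Bool.≟ true) M*

    M*-covered : ∀ {e} → e ∈ M* → Covered G e
    M*-covered = E-covered ∘ ⊑-lookup M*⊑E

    |S|≤opt : length S ≤ optSize E A′ B∖B[M₀]
    |S|≤opt = Matching⇒length-≤-ν
      (Sublist.filter⁺ (λ e → inS e Bool.≟ true) (λ e → inS e Bool.≟ true) (λ { refl h → h }) M*⊑E)
      (AllPairsₚ.filter⁺ (λ e → inS e Bool.≟ true) M*-matching)

    T-in-B[G] : ∀ {e} → e ∈ T → A′ (proj₁ e) ≡ true → proj₂ e ∈B G ≡ true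
    T-in-B[G] {e} e∈T a∈A′ with ∈-filter⁻ (λ e → not (inS e) Bool.≟ true) {xs = M*} e∈T
    ... | _ , e∉S with A′ (proj₁ e) | proj₂ e ∈B M₀ in b∈M₀
    ...   | true | true = ∈B-mono M₀⊆G b∈M₀
    ...   | true | false with () ← e∉S
    ...   | false | _ with () ← a∈A′

    |T|≤ : length T ≤ length (filter (λ g → not (A′ (proj₁ g)) Bool.≟ true) G) + length G
    |T|≤ = length-≤-charging G A′ T (AllPairsₚ.filter⁺ (λ e → not (inS e) Bool.≟ true) M*-matching)
      (M*-covered ∘ Subset.filter-⊆ (λ e → not (inS e) Bool.≟ true) M*) T-in-B[G]

    |S|+|T|≡ν : length S + length T ≡ ν E
    |S|+|T|≡ν = trans (length-filter-true+false inS M*) |M*|≡ν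

    ν≤2|G| : ν E ≤ 2 * length G
    ν≤2|G| = subst (_≤ 2 * length G) |M*|≡ν (length-≤-2*cover G M* M*-matching M*-covered)

module Averaging where
  open import Data.Integer as ℤ using (+_)
  import Data.Integer.Properties as ℤ
  open import Data.List using (List; _∷_; length; map)
  open import Data.List.Membership.Propositional using (_∈_)
  open import Data.Nat as ℕ using (ℕ; suc)
  open import Data.Nat.ListAction using (sum)
  import Data.Nat.Properties as ℕ
  open import Data.Rational using (ℚ; ½; _≤_; _≥_; _+_; _-_; _*_; _/_; -_; toℚᵘ; Positive)
  open import Data.Rational.Properties
  open import Data.Rational.Solver using (module +-*-Solver)
  import Data.Rational.Unnormalised as ℚᵘ
  import Data.Rational.Unnormalised.Properties as ℚᵘ
  open import Relation.Binary.PropositionalEquality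
  open Lists using (sum-map-+; sum-map-*ˡ; sum-map-const; sum-mono-≤)

  ι : ℕ → ℚ
  ι n = + n / 1

  toℚᵘ-/ : ∀ i d → toℚᵘ (i / suc d) ℚᵘ.≃ ℚᵘ.mkℚᵘ i d
  toℚᵘ-/ i d = toℚᵘ-fromℚᵘ (ℚᵘ.mkℚᵘ i d)

  ι-+ : ∀ m n → ι (m ℕ.+ n) ≡ ι m + ι n
  ι-+ m n = toℚᵘ-injective (begin
    toℚᵘ (ι (m ℕ.+ n))                         ≈⟨ toℚᵘ-/ (+ (m ℕ.+ n)) 0 ⟩
    ℚᵘ.mkℚᵘ (+ (m ℕ.+ n)) 0                    ≈⟨ ℚᵘ.*≡* (cong (ℤ._* + 1) numerators) ⟩
    ℚᵘ.mkℚᵘ (+ m) 0 ℚᵘ.+ ℚᵘ.mkℚᵘ (+ n) 0       ≈⟨ ℚᵘ.+-cong (toℚᵘ-/ (+ m) 0) (toℚᵘ-/ (+ n) 0) ⟨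
    toℚᵘ (ι m) ℚᵘ.+ toℚᵘ (ι n)                 ≈⟨ toℚᵘ-homo-+ (ι m) (ι n) ⟨
    toℚᵘ (ι m + ι n)                           ∎)
    where
    open ℚᵘ.≃-Reasoning
    numerators : + (m ℕ.+ n) ≡ + m ℤ.* + 1 ℤ.+ + n ℤ.* + 1
    numerators = trans (ℤ.pos-+ m n) (sym (cong₂ ℤ._+_ (ℤ.*-identityʳ (+ m)) (ℤ.*-identityʳ (+ n))))

  ι-* : ∀ m n → ι (m ℕ.* n) ≡ ι m * ι n
  ι-* m n = toℚᵘ-injective (begin
    toℚᵘ (ι (m ℕ.* n))                         ≈⟨ toℚᵘ-/ (+ (m ℕ.* n)) 0 ⟩
    ℚᵘ.mkℚᵘ (+ (m ℕ.* n)) 0                    ≈⟨ ℚᵘ.*≡* (cong (ℤ._* + 1) (ℤ.pos-* m n)) ⟩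
    ℚᵘ.mkℚᵘ (+ m) 0 ℚᵘ.* ℚᵘ.mkℚᵘ (+ n) 0       ≈⟨ ℚᵘ.*-cong (toℚᵘ-/ (+ m) 0) (toℚᵘ-/ (+ n) 0) ⟨
    toℚᵘ (ι m) ℚᵘ.* toℚᵘ (ι n)                 ≈⟨ toℚᵘ-homo-* (ι m) (ι n) ⟨
    toℚᵘ (ι m * ι n)                           ∎)
    where open ℚᵘ.≃-Reasoning

  ι-mono-≤ : ∀ {m n} → m ℕ.≤ n → ι m ≤ ι n
  ι-mono-≤ {m} {n} m≤n = toℚᵘ-cancel-≤ (begin
    toℚᵘ (ι m)        ≃⟨ toℚᵘ-/ (+ m) 0 ⟩
    ℚᵘ.mkℚᵘ (+ m) 0   ≤⟨ ℚᵘ.*≤* (ℤ.*-monoʳ-≤-nonNeg (+ 1) (ℤ.+≤+ m≤n)) ⟩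
    ℚᵘ.mkℚᵘ (+ n) 0   ≃⟨ toℚᵘ-/ (+ n) 0 ⟨
    toℚᵘ (ι n)        ∎)
    where open ℚᵘ.≤-Reasoning

  /-*-ι : ∀ m k → (+ m / suc k) * ι (suc k) ≡ ι m
  /-*-ι m k = toℚᵘ-injective (begin
    toℚᵘ (+ m / suc k * ι (suc k))                   ≈⟨ toℚᵘ-homo-* (+ m / suc k) (ι (suc k)) ⟩
    toℚᵘ (+ m / suc k) ℚᵘ.* toℚᵘ (ι (suc k))        ≈⟨ ℚᵘ.*-cong (toℚᵘ-/ (+ m) k) (toℚᵘ-/ (+ suc k) 0) ⟩
    ℚᵘ.mkℚᵘ (+ m) k ℚᵘ.* ℚᵘ.mkℚᵘ (+ suc k) 0        ≈⟨ ℚᵘ.*≡* (ℤ.*-assoc (+ m) (+ suc k) (+ 1)) ⟩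
    ℚᵘ.mkℚᵘ (+ m) 0                                  ≈⟨ toℚᵘ-/ (+ m) 0 ⟨
    toℚᵘ (ι m)                                       ∎)
    where open ℚᵘ.≃-Reasoning

  rearrange : ∀ {x y z v ε} → x + ι 2 * v ≤ y + ι 4 * z → z ≤ (½ + ε) * v → x - ι 4 * ε * v ≤ y
  rearrange {x} {y} {z} {v} {ε} x≤y+4z z≤ = begin
    x - ι 4 * ε * v              ≡⟨ split x (ι 4) ε v ½ ⟩
    (x + ι 2 * v) - w            ≤⟨ +-monoˡ-≤ (- w) x≤y+4z ⟩
    (y + ι 4 * z) - w            ≤⟨ +-monoˡ-≤ (- w) (+-monoʳ-≤ y (*-monoˡ-≤-nonNeg (ι 4) z≤)) ⟩
    (y + w) - w                  ≡⟨ cancel y w ⟩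
    y                            ∎
    where
    w = ι 4 * ((½ + ε) * v)
    open ≤-Reasoning
    open +-*-Solver
    -- [split] is stated with ½ and 4 as variables; ι 4 * ½ then computes to ι 2.
    split : ∀ x f e v h → x - f * e * v ≡ (x + f * h * v) - f * ((h + e) * v)
    split = solve 5 (λ x f e v h → x :- f :* e :* v := (x :+ f :* h :* v) :- f :* ((h :+ e) :* v)) refl
    cancel : ∀ y w → (y + w) - w ≡ y
    cancel = solve 2 (λ y w → (y :+ w) :- w := y) refl

  mean-bound : ∀ k S₁ S₂ S₃ V ε →
    S₁ ℕ.+ 2 ℕ.* V ℕ.* suc k ℕ.≤ S₂ ℕ.+ 4 ℕ.* S₃ →
    + S₃ / suc k ≤ (½ + ε) * ι V →
    + S₂ / suc k ≥ + S₁ / suc k - ι 4 * ε * ι V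
  mean-bound k S₁ S₂ S₃ V ε summed S₃-bound =
    rearrange {mean S₁} {mean S₂} {mean S₃} {ι V} {ε} averaged S₃-bound
    where
    n = suc k
    instance
      ι-n-positive : Positive (ι n)
      ι-n-positive = normalize-pos n 1

    mean : ℕ → ℚ
    mean S = + S / n

    ι≡mean*n : ∀ S → ι S ≡ mean S * ι n
    ι≡mean*n S = sym (/-*-ι S k)

    lhs : ι (S₁ ℕ.+ 2 ℕ.* V ℕ.* n) ≡ (mean S₁ + ι 2 * ι V) * ι n
    lhs = begin
      ι (S₁ ℕ.+ 2 ℕ.* V ℕ.* n)              ≡⟨ ι-+ S₁ (2 ℕ.* V ℕ.* n) ⟩
      ι S₁ + ι (2 ℕ.* V ℕ.* n)              ≡⟨ cong₂ _+_ (ι≡mean*n S₁)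
                                                 (trans (ι-* (2 ℕ.* V) n) (cong (_* ι n) (ι-* 2 V))) ⟩
      mean S₁ * ι n + ι 2 * ι V * ι n       ≡⟨ *-distribʳ-+ (ι n) (mean S₁) (ι 2 * ι V) ⟨
      (mean S₁ + ι 2 * ι V) * ι n           ∎
      where open ≡-Reasoning

    rhs : ι (S₂ ℕ.+ 4 ℕ.* S₃) ≡ (mean S₂ + ι 4 * mean S₃) * ι n
    rhs = begin
      ι (S₂ ℕ.+ 4 ℕ.* S₃)                   ≡⟨ ι-+ S₂ (4 ℕ.* S₃) ⟩
      ι S₂ + ι (4 ℕ.* S₃)                   ≡⟨ cong₂ _+_ (ι≡mean*n S₂)
                                                 (trans (ι-* 4 S₃) (cong (ι 4 *_) (ι≡mean*n S₃))) ⟩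
      mean S₂ * ι n + ι 4 * (mean S₃ * ι n) ≡⟨ cong (_+_ (mean S₂ * ι n)) (*-assoc (ι 4) (mean S₃) (ι n)) ⟨
      mean S₂ * ι n + ι 4 * mean S₃ * ι n   ≡⟨ *-distribʳ-+ (ι n) (mean S₂) (ι 4 * mean S₃) ⟨
      (mean S₂ + ι 4 * mean S₃) * ι n       ∎
      where open ≡-Reasoning

    averaged : mean S₁ + ι 2 * ι V ≤ mean S₂ + ι 4 * mean S₃
    averaged = *-cancelʳ-≤-pos (ι n) (subst₂ _≤_ lhs rhs (ι-mono-≤ summed))

  expect-bound : {X : Set} {x : X} {L : List X} (f g h : X → ℕ) (V : ℕ) (ε : ℚ) → x ∈ L →
    (∀ {x} → x ∈ L → f x ℕ.+ 2 ℕ.* V ℕ.≤ g x ℕ.+ 4 ℕ.* h x) →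
    expect L h ≤ (½ + ε) * ι V → expect L g ≥ expect L f - ι 4 * ε * ι V
  expect-bound {L = y ∷ ys} f g h V ε _ pointwise =
    mean-bound (length ys) (sum (map f L)) (sum (map g L)) (sum (map h L)) V ε summed
    where
    L = y ∷ ys
    open ℕ.≤-Reasoning
    summed : sum (map f L) ℕ.+ 2 ℕ.* V ℕ.* length L ℕ.≤ sum (map g L) ℕ.+ 4 ℕ.* sum (map h L)
    summed = begin
      sum (map f L) ℕ.+ 2 ℕ.* V ℕ.* length L          ≡⟨ cong (sum (map f L) ℕ.+_) (sum-map-const (2 ℕ.* V) L) ⟨
      sum (map f L) ℕ.+ sum (map (λ _ → 2 ℕ.* V) L)   ≡⟨ sum-map-+ f (λ _ → 2 ℕ.* V) L ⟨
      sum (map (λ x → f x ℕ.+ 2 ℕ.* V) L)             ≤⟨ sum-mono-≤ pointwise ⟩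
      sum (map (λ x → g x ℕ.+ 4 ℕ.* h x) L)           ≡⟨ sum-map-+ g (λ x → 4 ℕ.* h x) L ⟩
      sum (map g L) ℕ.+ sum (map (λ x → 4 ℕ.* h x) L) ≡⟨ cong (sum (map g L) ℕ.+_) (sum-map-*ˡ 4 h L) ⟩
      sum (map g L) ℕ.+ 4 ℕ.* sum (map h L)           ∎

open Lists using (∧-true⁻)
open Matchings

pointwise-bound : ∀ {p q} (E π : List (Edge p q)) (α β : ℚ) → E ⊆ π →
  length (M₁ π α β) ℕ.+ 2 ℕ.* ν E ℕ.≤ optSize E (A' π α β) (BnotM₀ π α β) ℕ.+ 4 ℕ.* length (Greedy π)
pointwise-bound {p} {q} E π α β E⊆π =
  GreedyPhases.bound (Greedy π) (M₀ π α β) (M₁ π α β) (Greedy-take-⊆ (floorMul α (length π)) π)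
    (Greedy-matching F₁-window) M₁-in-B[M₀] E (Greedy-maximal π ∘ E⊆π)
  where
  F₁-window : List (Edge p q)
  F₁-window = filter (λ e → inF₁ π α β e Bool.≟ true) (window α β π)

  M₁-in-B[M₀] : ∀ {e} → e ∈ M₁ π α β → proj₂ e ∈B M₀ π α β ≡ true
  M₁-in-B[M₀] {e} e∈M₁ with _ , e∈F₁ ← ∈-filter⁻ (λ e → inF₁ π α β e Bool.≟ true) {xs = window α β π}
                                                   (Greedy-⊆ F₁-window e∈M₁) =
    proj₁ (∧-true⁻ (proj₂ e ∈B M₀ π α β) e∈F₁)

open import Data.List.Relation.Unary.Unique.Propositional using (Unique)
open import Data.Integer using (+_)
open import Data.Rational using (0ℚ; ½; _<_; _≤_; _≥_; _+_; _-_; _*_; _/_)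
open Orderings using (∈-orderings; orderings-⊇)
open Averaging using (expect-bound)

lemma7 : (p q : ℕ) (E : List (Edge p q)) → Unique E →
    (α β ε : ℚ) → 0ℚ < α → α ≤ ½ → ½ < β → β < (+ 1) / 1 →
    expect (orderings E) (λ π → length (Greedy π)) ≤ (½ + ε) * ((+ ν E) / 1) →
    expect (orderings E) (λ π → optSize E (A' π α β) (BnotM₀ π α β))
      ≥ expect (orderings E) (λ π → length (M₁ π α β)) - ((+ 4) / 1) * ε * ((+ ν E) / 1)
lemma7 p q E _ α β ε _ _ _ _ greedy-bound =
  expect-bound (λ π → length (M₁ π α β)) (λ π → optSize E (A' π α β) (BnotM₀ π α β))
    (λ π → length (Greedy π)) (ν E) ε (∈-orderings E) (λ π∈ → pointwise-bound E _ α β (orderings-⊇ π∈))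
    greedy-bound
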